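{- Let $\ell$ be a setup mapping with $\ell(\tau,\tau)=0$ for every type $\tau$ that satisfies the triangle inequality. Let $(J,\ell,\pi,k)$ be an instance of \textsc{Window LS MM} or of \textsc{Multi-Window LS MM}, and suppose there exists a schedule that is better than $\pi$ and has distance at most $k$ from $\pi$ (window distance, respectively multi-window distance). Then there exists a schedule $\pi'$ that is better than $\pi$ and has distance at most $k$ from $\pi$ such that: (a) in the case of the window distance, the rearranged window $\pi'[a,b]$ is an EDDS (where $a$ and $b$ are the smallest and largest indices $i$ with $\pi(i)\neq\pi'(i)$); (b) in the case of the multi-window distance, there is a partition of $[1,n]$ into consecutive intervals $I_1,\dots,I_m$, each of length at most $k$, such that for each $i$ the sets of jobs $\{\pi(t): t\in I_i\}$ and $\{\pi'(t): t\in I_i\}$ coincide, and each rearranged window $\pi'[I_i]$ is an EDDS.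
   Context: A job is a triple $j=(t_j,d_j,\tau_j)$ with processing time $t_j\in\mathbb{N}_0$, deadline $d_j\in\mathbb{N}_0$ and type $\tau_j\in\mathcal{T}$. A setup mapping is $\ell:\mathcal{T}\times\mathcal{T}\to\mathbb{N}_0$; it satisfies the triangle inequality if $\ell(\tau_1,\tau_3)\le\ell(\tau_1,\tau_2)+\ell(\tau_2,\tau_3)$ for all types. For a job set $J$ of $n$ jobs, a schedule is a permutation $\pi$ of $J$ (with $\pi(i)$ the $i$th job). Completion times: $C_\pi(1)=t_{\pi(1)}$ and $C_\pi(i)=C_\pi(i-1)+\ell(\tau_{\pi(i-1)},\tau_{\pi(i)})+t_{\pi(i)}$ for $i>1$; the makespan $C^\pi_{\max}$ is $C_\pi(n)$. The total tardiness is $\sum_i\max(C_\pi(i)-d_{\pi(i)},0)$ and $\pi$ is feasible if its total tardiness is $0$. For a distance measure $\delta$ on schedules, \textsc{$\delta$ LS MM} gets a job set $J$, a setup mapping $\ell$, a feasible schedule $\pi$ of $J$ and an integer $k$, and asks to find a schedule $\pi'$ with $\delta(\pi,\pi')\le k$ that is better than $\pi$, i.e. $\pi'$ is feasible and $C^{\pi'}_{\max}<C^\pi_{\max}$, or report that none exists. $\pi[i,j]$ denotes the subsequence $(\pi(i),\dots,\pi(j))$ and $\pi[I]$ the subsequence on an interval $I$. Window distance: $0$ if $\pi=\pi'$; otherwise $b-a+1$ where $a$ ($b$) is the smallest (largest) index $i$ with $\pi(i)\ne\pi'(i)$; \textsc{Window LS MM} is \textsc{$\delta$ LS MM} for this $\delta$,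 and $\pi'[a,b]$ is called the rearranged window. Multi-window distance: $\pi,\pi'$ decompose into $k$-intervals if either they have length at most $k$, or there is $i\in[n-k,n]$ with $\{\pi(t):t\in[i+1,n]\}=\{\pi'(t):t\in[i+1,n]\}$ and $\pi[1,i],\pi'[1,i]$ decompose into $k$-intervals; the multi-window distance is the minimum $k$ for which they decompose into $k$-intervals. The resulting partition of $[1,n]$ into intervals $I_1,\dots,I_m$ gives the rearranged windows $\pi'[I_i]$. \textsc{Multi-Window LS MM} is \textsc{$\delta$ LS MM} for this $\delta$. A sequence of jobs is an earliest due date schedule (EDDS) if, for every type $\tau$, the subsequence of its jobs of type $\tau$ is ordered non-decreasingly by deadline. -}

module Defs where

open import Data.Nat using (ℕ; zero; suc; _+_; _∸_; _≤_; _<_)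
open import Data.Fin using (Fin; toℕ)
open import Data.Fin.Properties using (_≟_)
open import Data.Nat.ListAction using (sum)
open import Data.List using (List; []; _∷_; _++_; length; zipWith; filter; map; take; drop; concat; allFin; tabulate)
open import Data.List.Membership.Propositional using (_∈_)
open import Data.List.Relation.Unary.AllPairs using (AllPairs)
open import Data.List.Relation.Unary.All using (All)
open import Data.List.Relation.Binary.Pointwise using (Pointwise)
open import Data.Product using (Σ; ∃; ∃-syntax; _×_; _,_)
open import Data.Sum using (_⊎_)
open import Function.Definitions using (Injective)
open import Function.Bundles using (_⇔_)
open import Relation.Binary.PropositionalEquality using (_≡_; _≢_)
open import Relation.Nullary using (¬_; ¬?)

record Job (T : Set) : Set where
  constructor job
  field
    t : ℕ   -- processing time
    d : ℕ   -- deadline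
    τ : T   -- type
open Job public

SetupMapping : Set → Set
SetupMapping T = T → T → ℕ

ZeroOnDiagonal : {T : Set} → SetupMapping T → Set
ZeroOnDiagonal {T} ℓ = (x : T) → ℓ x x ≡ 0

TriangleInequality : {T : Set} → SetupMapping T → Set
TriangleInequality {T} ℓ = (x y z : T) → ℓ x z ≤ ℓ x y + ℓ y z

-- A job set of n jobs is J : Fin n → Job T (jobs are identified by
-- their index, so distinct jobs may carry equal triples).
-- A schedule is a permutation of the jobs: an injective map
-- π : Fin n → Fin n, where π i is the job at position i (0-based).

Schedule : ℕ → Set
Schedule n = Σ (Fin n → Fin n) (Injective _≡_ _≡_)

ids : {n : ℕ} → Schedule n → List (Fin n)
ids (π , _) = tabulate π

jobsOf : {T : Set} {n : ℕ} → (Fin n → Job T) → Schedule n → List (Job T)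
jobsOf J σ = map J (ids σ)

module _ {T : Set} (ℓ : SetupMapping T) where

  completionsFrom : Job T → ℕ → List (Job T) → List ℕ
  completionsFrom p c [] = c ∷ []
  completionsFrom p c (k ∷ ks) = c ∷ completionsFrom k (c + ℓ (τ p) (τ k) + t k) ks

  completions : List (Job T) → List ℕ
  completions [] = []
  completions (j ∷ js) = completionsFrom j (t j) js

  lastOr : ℕ → List ℕ → ℕ
  lastOr c [] = c
  lastOr c (x ∷ xs) = lastOr x xs

  -- makespan = completion time of the last job (0 for the empty schedule)
  makespan : List (Job T) → ℕ
  makespan js = lastOr 0 (completions js)

  -- total tardiness: Σ max(C(i) - d_{π(i)}, 0)   (truncated subtraction on ℕ)
  totalTardiness : List (Job T) → ℕ
  totalTardiness js = sum (zipWith (λ c j → c ∸ d j) (completions js) js)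

  Feasible : List (Job T) → Set
  Feasible js = totalTardiness js ≡ 0

  Better : {n : ℕ} → (Fin n → Job T) → Schedule n → Schedule n → Set
  Better J π π' = Feasible (jobsOf J π') × makespan (jobsOf J π') < makespan (jobsOf J π)

EDDS : {T : Set} → List (Job T) → Set
EDDS = AllPairs (λ x y → τ x ≡ τ y → d x ≤ d y)

diffPositions : {n : ℕ} → Schedule n → Schedule n → List (Fin n)
diffPositions {n} (π , _) (π' , _) = filter (λ i → ¬? (π i ≟ π' i)) (allFin n)

lastFin : {n : ℕ} → Fin n → List (Fin n) → Fin n
lastFin x [] = x
lastFin x (y ∷ ys) = lastFin y ys

windowDist : {n : ℕ} → Schedule n → Schedule n → ℕ
windowDist π π' with diffPositions π π'
... | [] = 0
... | a ∷ rest = suc (toℕ (lastFin a rest) ∸ toℕ a)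

FirstLastDiff : {n : ℕ} → Schedule n → Schedule n → Fin n → Fin n → Set
FirstLastDiff {n} (π , _) (π' , _) a b =
  π a ≢ π' a × π b ≢ π' b ×
  ((i : Fin n) → π i ≢ π' i → toℕ a ≤ toℕ i × toℕ i ≤ toℕ b)

-- the subsequence on positions [a, b] (0-based, inclusive)
slice : {A : Set} → ℕ → ℕ → List A → List A
slice a b xs = take (suc b ∸ a) (drop a xs)

SameSet : {A : Set} → List A → List A → Set
SameSet xs ys = ∀ x → (x ∈ xs) ⇔ (x ∈ ys)

-- π, π' (here as sequences of job identities of equal length)
-- decompose into k-intervals
data Decomp {A : Set} (k : ℕ) : List A → List A → Set where
  short : ∀ {xs ys} → length xs ≡ length ys → length xs ≤ k → Decomp k xs ys
  split : ∀ {xs₁ xs₂ ys₁ ys₂} →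
          length xs₂ ≡ length ys₂ → length xs₂ ≤ k →
          SameSet xs₂ ys₂ →
          Decomp k xs₁ ys₁ →
          Decomp k (xs₁ ++ xs₂) (ys₁ ++ ys₂)

MultiWindowDist : {n : ℕ} → Schedule n → Schedule n → ℕ → Set
MultiWindowDist π π' m =
  Decomp m (ids π) (ids π') × ((m' : ℕ) → m' < m → ¬ Decomp m' (ids π) (ids π'))

MultiWindowDist≤ : {n : ℕ} → Schedule n → Schedule n → ℕ → Set
MultiWindowDist≤ π π' k = ∃[ m ] (MultiWindowDist π π' m × m ≤ k)

-- a partition of the positions [1,n] into consecutive nonempty intervals,
-- given as the corresponding blocks of the two sequences: block i of π
-- and block i of π' cover the same interval I_i, which has length ≤ k;
-- they contain the same jobs, and the block of π' is an EDDS.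
GoodBlocks : {T : Set} {n : ℕ} → (Fin n → Job T) → ℕ →
             List (List (Fin n)) → List (List (Fin n)) → Set
GoodBlocks J k = Pointwise (λ xs ys →
  length xs ≡ length ys × 1 ≤ length xs × length xs ≤ k ×
  SameSet xs ys × EDDS (map J ys))

MultiWindowNormalForm : {T : Set} {n : ℕ} → (Fin n → Job T) → ℕ →
                        Schedule n → Schedule n → Set
MultiWindowNormalForm {n = n} J k π π' =
  ∃[ xss ] ∃[ yss ] (concat xss ≡ ids π × concat yss ≡ ids π' × GoodBlocks J k xss yss)

{-# OPTIONS --safe #-}

-- Follow a job sequence through the machine state after each job: the type of the last job and
-- its completion time, which fix when a job of any type can start next. Call xs′ dominating xs if,
-- started from a state that is nowhere later, xs′ meets every deadline that xs meets and ends in a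
-- state that is nowhere later. Dominance is a preorder compatible with concatenation, and a
-- dominating rearrangement of a feasible sequence is feasible with no larger makespan.
--
-- If the setups between the types of x and y vanish in both directions and d y < d x, then moving
-- x from in front of B y to directly behind y dominates, by the triangle inequality. An insertion
-- sort made of such moves turns any sequence into a dominating EDDS (jobs of equal type have zero
-- setup). Sorting each rearranged window of a better schedule σ thus gives a better schedule that
-- differs from π only inside the windows of σ and is an EDDS there.

module Submission where

open import Defs
open import Data.Nat using (ℕ; _≤_)
open import Data.Fin using (Fin; toℕ)
open import Data.Product using (_×_; ∃-syntax; _,_)

open import Data.Empty using (⊥-elim)
open import Data.Fin using (fromℕ; fromℕ<; punchOut) renaming (zero to fzero; suc to fsuc; _<_ to _<ᶠ_)
import Data.Fin.Properties as Finₚ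
open import Data.List using (List; []; _∷_; _++_; [_]; allFin; concat; drop; filter; foldl; length; lookup; map; tabulate; take; zipWith)
import Data.List.Membership.DecPropositional as DecMembership
open import Data.List.Membership.Propositional using (_∈_)
import Data.List.Membership.Propositional.Properties as ∈ₚ
import Data.List.Properties as Listₚ
open import Data.List.Relation.Binary.Permutation.Propositional using (_↭_; ↭-refl; ↭-sym; ↭-trans; swap; ↭⇒↭ₛ)
import Data.List.Relation.Binary.Permutation.Propositional.Properties as ↭ₚ
import Data.List.Relation.Binary.Permutation.Setoid.Properties as ↭ₛₚ
open import Data.List.Relation.Binary.Pointwise as Pointwise using (Pointwise; []; _∷_)
open import Data.List.Relation.Unary.All as All using (All; []; _∷_)
import Data.List.Relation.Unary.All.Properties as Allₚ
open import Data.List.Relation.Unary.AllPairs as AllPairs using (AllPairs; []; _∷_)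
import Data.List.Relation.Unary.AllPairs.Properties as AllPairsₚ
open import Data.List.Relation.Unary.Any using (here; there)
open import Data.List.Relation.Unary.Unique.Propositional using (Unique)
import Data.List.Relation.Unary.Unique.Propositional.Properties as Uniqueₚ
open import Data.Nat using (zero; suc; _+_; _∸_; _⊓_; _<_; z≤n; s≤s; s≤s⁻¹; _≟_; _<?_; _≤?_)
open import Data.Nat.ListAction using (sum)
open import Data.Nat.Properties
open import Algebra.Properties.CommutativeSemigroup +-commutativeSemigroup using (xy∙z≈xz∙y)
open import Data.Product using (Σ; ∃; proj₁; proj₂)
open import Data.Sum using (_⊎_; inj₁; inj₂)
open import Data.Unit using (⊤; tt)
open import Function using (_∘_; flip)
open import Function.Bundles using (Equivalence; mk⇔)
open import Function.Definitions using (Injective)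
open import Relation.Binary using (Decidable)
open import Relation.Binary.PropositionalEquality using (_≡_; _≢_; refl; sym; trans; cong; cong₂; subst; subst₂; setoid)
open import Relation.Nullary using (¬_; ¬?; Dec; yes; no; contradiction)
open import Relation.Nullary.Decidable using (_×-dec_; _→-dec_; map′; decidable-stable)

m+k≤n⇒m+o+k≤n+o : ∀ {m n} k o → m + k ≤ n → m + o + k ≤ n + o
m+k≤n⇒m+o+k≤n+o {m} {n} k o m+k≤n = begin
  m + o + k ≡⟨ xy∙z≈xz∙y m o k ⟩
  m + k + o ≤⟨ +-monoˡ-≤ o m+k≤n ⟩
  n + o     ∎
  where open ≤-Reasoning

least : ∀ {P : ℕ → Set} → (∀ m → Dec (P m)) → ∀ {k} → P k →
        ∃[ m ] ((P m × (∀ m′ → m′ < m → ¬ P m′)) × m ≤ k)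
least {P} P? {k} Pk
  with i , ¬¬Pi , below ← Finₚ.¬∀⟶∃¬-smallest (suc k) (λ i → ¬ P (toℕ i)) (λ i → ¬? (P? (toℕ i)))
                            (λ ∀¬P → ∀¬P (fromℕ k) (subst P (sym (Finₚ.toℕ-fromℕ k)) Pk))
  = toℕ i , (decidable-stable (P? (toℕ i)) ¬¬Pi , ¬P-below) , s≤s⁻¹ (Finₚ.toℕ<n i)
  where
  ¬P-below : ∀ m′ → m′ < toℕ i → ¬ P m′
  ¬P-below m′ m′<i = subst (¬_ ∘ P) (trans (Finₚ.toℕ-inject (fromℕ< m′<i)) (Finₚ.toℕ-fromℕ< m′<i))
                             (below (fromℕ< m′<i))

lookup-injective : ∀ {A : Set} {xs : List A} → Unique xs → Injective _≡_ _≡_ (lookup xs)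
lookup-injective (_ ∷ _)   {fzero}  {fzero}  _  = refl
lookup-injective (x∉ ∷ _)  {fzero}  {fsuc j} x≡ = contradiction x≡ (All.lookup x∉ (∈ₚ.∈-lookup j))
lookup-injective (x∉ ∷ _)  {fsuc i} {fzero}  ≡x = contradiction (sym ≡x) (All.lookup x∉ (∈ₚ.∈-lookup i))
lookup-injective (_ ∷ xs!) {fsuc i} {fsuc j} eq = cong fsuc (lookup-injective xs! eq)

Unique⇒tabulate : ∀ {A : Set} {m} (xs : List A) → length xs ≡ m → Unique xs →
                  Σ (Fin m → A) λ f → Injective _≡_ _≡_ f × tabulate f ≡ xs
Unique⇒tabulate xs refl xs! = lookup xs , lookup-injective xs! , Listₚ.tabulate-lookup xs

injective⇒surjective : ∀ {n} {f : Fin n → Fin n} → Injective _≡_ _≡_ f → ∀ y → ∃ λ i → f i ≡ y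
injective⇒surjective {suc n} {f} f-injective y with Finₚ.any? (λ i → f i Finₚ.≟ y)
... | yes hit = hit
... | no miss = ⊥-elim (Finₚ.<⇒notInjective (n<1+n n) g-injective)
  where
  y≢f : ∀ i → y ≢ f i
  y≢f i y≡fi = miss (i , sym y≡fi)
  g : Fin (suc n) → Fin n
  g i = punchOut (y≢f i)
  g-injective : Injective _≡_ _≡_ g
  g-injective {i} {j} = f-injective ∘ Finₚ.punchOut-injective (y≢f i) (y≢f j)

tabulate-injective : ∀ {A : Set} {m} {f g : Fin m → A} → tabulate f ≡ tabulate g → ∀ i → f i ≡ g i
tabulate-injective f≡g fzero    = Listₚ.∷-injectiveˡ f≡g
tabulate-injective f≡g (fsuc i) = tabulate-injective (Listₚ.∷-injectiveʳ f≡g) i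

tabulate-≡-prefix : ∀ {A : Set} {m} {f g : Fin m → A} P {xs ys} →
  tabulate f ≡ P ++ xs → tabulate g ≡ P ++ ys → ∀ i → toℕ i < length P → f i ≡ g i
tabulate-≡-prefix (_ ∷ P) f≡ g≡ fzero    _         =
  trans (Listₚ.∷-injectiveˡ f≡) (sym (Listₚ.∷-injectiveˡ g≡))
tabulate-≡-prefix (_ ∷ P) f≡ g≡ (fsuc i) (s≤s i<P) =
  tabulate-≡-prefix P (Listₚ.∷-injectiveʳ f≡) (Listₚ.∷-injectiveʳ g≡) i i<P

tabulate-≡-suffix : ∀ {A : Set} {m} {f g : Fin m → A} xs ys {S} → length xs ≡ length ys →
  tabulate f ≡ xs ++ S → tabulate g ≡ ys ++ S → ∀ i → length xs ≤ toℕ i → f i ≡ g i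
tabulate-≡-suffix []       []       _   f≡ g≡ i        _         = tabulate-injective (trans f≡ (sym g≡)) i
tabulate-≡-suffix (_ ∷ xs) (_ ∷ ys) len f≡ g≡ (fsuc i) (s≤s xs≤i) =
  tabulate-≡-suffix xs ys (suc-injective len) (Listₚ.∷-injectiveʳ f≡) (Listₚ.∷-injectiveʳ g≡) i xs≤i

tabulate-≡-outside : ∀ {A : Set} {m} {f g : Fin m → A} P {X Y S} → length X ≡ length Y →
  tabulate f ≡ P ++ X ++ S → tabulate g ≡ P ++ Y ++ S →
  ∀ i → toℕ i < length P ⊎ length P + length X ≤ toℕ i → f i ≡ g i
tabulate-≡-outside P         _     f≡ g≡ i (inj₁ i<P)    = tabulate-≡-prefix P f≡ g≡ i i<P
tabulate-≡-outside P {X} {Y} {S} |X|≡|Y| f≡ g≡ i (inj₂ PX≤i) =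
  tabulate-≡-suffix (P ++ X) (P ++ Y)
    (trans (Listₚ.length-++ P) (trans (cong (length P +_) |X|≡|Y|) (sym (Listₚ.length-++ P))))
    (trans f≡ (sym (Listₚ.++-assoc P X S))) (trans g≡ (sym (Listₚ.++-assoc P Y S)))
    i (subst (_≤ toℕ i) (sym (Listₚ.length-++ P)) PX≤i)

split-at : ∀ {A : Set} (xs : List A) {m} → m ≤ length xs → ∃[ ys ] ∃[ zs ] (xs ≡ ys ++ zs × length ys ≡ m)
split-at xs {m} m≤xs = take m xs , drop m xs , sym (Listₚ.take++drop≡id m xs) ,
  trans (Listₚ.length-take m xs) (m≤n⇒m⊓n≡m m≤xs)

window-split : ∀ {A : Set} (xs : List A) {a b} → a ≤ b → b < length xs →
  ∃[ P ] ∃[ X ] ∃[ S ] (xs ≡ P ++ X ++ S × length P ≡ a × length P + length X ≡ suc b)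
window-split xs {a} {b} a≤b b<xs
  with Q , S , xs≡QS , |Q|≡1+b ← split-at xs b<xs
  with P , X , Q≡PX , |P|≡a ← split-at Q (subst (a ≤_) (sym |Q|≡1+b) (m≤n⇒m≤1+n a≤b))
  = P , X , S , trans xs≡QS (trans (cong (_++ S) Q≡PX) (Listₚ.++-assoc P X S)) , |P|≡a ,
    trans (sym (Listₚ.length-++ P)) (trans (cong length (sym Q≡PX)) |Q|≡1+b)

take-length-++ : ∀ {A : Set} (xs : List A) {ys} → take (length xs) (xs ++ ys) ≡ xs
take-length-++ []       = refl
take-length-++ (x ∷ xs) = cong (x ∷_) (take-length-++ xs)

drop-length-++ : ∀ {A : Set} (xs : List A) {ys} → drop (length xs) (xs ++ ys) ≡ ys
drop-length-++ []       = refl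
drop-length-++ (x ∷ xs) = drop-length-++ xs

take-++-≤ : ∀ {A : Set} m (xs : List A) {ys} → m ≤ length xs → take m (xs ++ ys) ≡ take m xs
take-++-≤ zero    xs       _         = refl
take-++-≤ (suc m) (x ∷ xs) (s≤s m≤xs) = cong (x ∷_) (take-++-≤ m xs m≤xs)

AllPairs-slice : ∀ {A : Set} {R : A → A → Set} P {X} S {i j} → AllPairs R X →
  length P ≤ i → i ≤ j → j < length P + length X → AllPairs R (slice i j (P ++ X ++ S))
AllPairs-slice (_ ∷ P) S R-X (s≤s P≤i) (s≤s i≤j) (s≤s j<PX) = AllPairs-slice P S R-X P≤i i≤j j<PX
AllPairs-slice [] {X} S {zero} {j} R-X _ _ j<X =
  subst (AllPairs _) (sym (take-++-≤ (suc j) X j<X)) (AllPairsₚ.take⁺ (suc j) R-X)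
AllPairs-slice [] {_ ∷ X} S {suc i} (_ ∷ R-X) _ (s≤s i≤j) (s≤s j<X) = AllPairs-slice [] S R-X z≤n i≤j j<X

slice-map : ∀ {A B : Set} (f : A → B) i j xs → slice i j (map f xs) ≡ map f (slice i j xs)
slice-map f i j xs =
  trans (cong (take (suc j ∸ i)) (Listₚ.drop-map i xs)) (Listₚ.take-map (suc j ∸ i) (drop i xs))

Unique-++⁻ˡ : ∀ {A : Set} (xs : List A) {ys} → Unique (xs ++ ys) → Unique xs
Unique-++⁻ˡ []       _           = []
Unique-++⁻ˡ (x ∷ xs) (x∉ ∷ xs!) = Allₚ.++⁻ˡ xs x∉ ∷ Unique-++⁻ˡ xs xs!

Unique-++-disjoint : ∀ {A : Set} (xs : List A) {ys z} → Unique (xs ++ ys) → z ∈ xs → ¬ z ∈ ys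
Unique-++-disjoint (x ∷ xs) (x∉ ∷ _)   (here refl) z∈ys = All.lookup x∉ (∈ₚ.∈-++⁺ʳ xs z∈ys) refl
Unique-++-disjoint (x ∷ xs) (_ ∷ xs!) (there z∈xs) z∈ys = Unique-++-disjoint xs xs! z∈xs z∈ys

SameSet-++-cancelʳ : ∀ {A : Set} (xs₁ ys₁ : List A) {xs₂ ys₂} →
                     Unique (xs₁ ++ xs₂) → Unique (ys₁ ++ ys₂) →
                     SameSet (xs₁ ++ xs₂) (ys₁ ++ ys₂) → SameSet xs₂ ys₂ → SameSet xs₁ ys₁
SameSet-++-cancelʳ xs₁ ys₁ xs! ys! same same₂ z = mk⇔
  (keep xs₁ ys₁ xs! (Equivalence.to (same z)) (Equivalence.from (same₂ z)))
  (keep ys₁ xs₁ ys! (Equivalence.from (same z)) (Equivalence.to (same₂ z)))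
  where
  keep : ∀ us vs {us₂ vs₂} → Unique (us ++ us₂) →
         (z ∈ us ++ us₂ → z ∈ vs ++ vs₂) → (z ∈ vs₂ → z ∈ us₂) → z ∈ us → z ∈ vs
  keep us vs us! to back z∈us with ∈ₚ.∈-++⁻ vs (to (∈ₚ.∈-++⁺ˡ z∈us))
  ... | inj₁ z∈vs  = z∈vs
  ... | inj₂ z∈vs₂ = contradiction (back z∈vs₂) (Unique-++-disjoint us us! z∈us)

SameSet-↭ʳ : ∀ {A : Set} {xs ys zs : List A} → ys ↭ zs → SameSet xs ys → SameSet xs zs
SameSet-↭ʳ ys↭zs same x =
  mk⇔ (↭ₚ.∈-resp-↭ ys↭zs ∘ Equivalence.to (same x)) (Equivalence.from (same x) ∘ ↭ₚ.∈-resp-↭ (↭-sym ys↭zs))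

-- Job sequences: timing and dominance

module Timing {T : Set} (ℓ : SetupMapping T) {A : Set} (J : A → Job T) where

  data State : Set where
    start : State
    after : T → ℕ → State

  ready : State → T → ℕ
  ready start        _ = 0
  ready (after τ′ c) z = c + ℓ τ′ z

  completion : State → A → ℕ
  completion s x = ready s (τ (J x)) + t (J x)

  step : State → A → State
  step s x = after (τ (J x)) (completion s x)

  run : State → List A → State
  run s []       = s
  run s (x ∷ xs) = run (step s x) xs

  finish : State → ℕ
  finish start       = 0
  finish (after _ c) = c

  OnTime : State → List A → Set
  OnTime s []       = ⊤
  OnTime s (x ∷ xs) = completion s x ≤ d (J x) × OnTime (step s x) xs

  infix 4 _≼[_]_
  record _≼[_]_ (s′ : State) (k : ℕ) (s : State) : Set where
    constructor ahead
    field ready-≤ : ∀ z → ready s′ z + k ≤ ready s z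
  open _≼[_]_

  ≼-refl : ∀ {s} → s ≼[ 0 ] s
  ≼-refl = ahead λ z → ≤-reflexive (+-identityʳ _)

  ≼-trans : ∀ {s₁ s₂ s₃ j k} → s₁ ≼[ j ] s₂ → s₂ ≼[ k ] s₃ → s₁ ≼[ j + k ] s₃
  ≼-trans {s₁} {j = j} {k} h₁ h₂ = ahead λ z → begin
    ready s₁ z + (j + k) ≡⟨ +-assoc (ready s₁ z) j k ⟨
    ready s₁ z + j + k   ≤⟨ +-monoˡ-≤ k (ready-≤ h₁ z) ⟩
    _                    ≤⟨ ready-≤ h₂ z ⟩
    _                    ∎
    where open ≤-Reasoning

  module _ {s′ s k} (s′≼s : s′ ≼[ k ] s) where

    completion-mono : ∀ x → completion s′ x + k ≤ completion s x
    completion-mono x = m+k≤n⇒m+o+k≤n+o k (t (J x)) (ready-≤ s′≼s (τ (J x)))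

    completion-≤ : ∀ x → completion s′ x ≤ completion s x
    completion-≤ x = ≤-trans (m≤m+n _ k) (completion-mono x)

    step-mono : ∀ x → step s′ x ≼[ k ] step s x
    step-mono x = ahead λ z → m+k≤n⇒m+o+k≤n+o k (ℓ (τ (J x)) z) (completion-mono x)

  run-mono : ∀ {s′ s k} xs → s′ ≼[ k ] s → OnTime s xs → OnTime s′ xs × run s′ xs ≼[ k ] run s xs
  run-mono []       s′≼s _                  = tt , s′≼s
  run-mono (x ∷ xs) s′≼s (on-time , rest) =
    let on-time′ , ≼-end = run-mono xs (step-mono s′≼s x) rest
    in (≤-trans (completion-≤ s′≼s x) on-time , on-time′) , ≼-end

  run-++ : ∀ s xs ys → run s (xs ++ ys) ≡ run (run s xs) ys
  run-++ s []       ys = refl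
  run-++ s (x ∷ xs) ys = run-++ (step s x) xs ys

  completion-step-zero-setup : ∀ s {x y} → ℓ (τ (J y)) (τ (J x)) ≡ 0 →
                               completion (step s y) x ≡ completion s y + t (J x)
  completion-step-zero-setup s {x} {y} ℓyx≡0 =
    trans (cong (λ l → completion s y + l + t (J x)) ℓyx≡0) (cong (_+ t (J x)) (+-identityʳ _))

  OnTime-++⁻ : ∀ {s} xs {ys} → OnTime s (xs ++ ys) → OnTime s xs × OnTime (run s xs) ys
  OnTime-++⁻ []       on-time          = tt , on-time
  OnTime-++⁻ (x ∷ xs) (on-time , rest) =
    let on-xs , on-ys = OnTime-++⁻ xs rest in (on-time , on-xs) , on-ys

  OnTime-++⁺ : ∀ {s} xs {ys} → OnTime s xs → OnTime (run s xs) ys → OnTime s (xs ++ ys)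
  OnTime-++⁺ []       _                on-ys = on-ys
  OnTime-++⁺ (x ∷ xs) (on-time , on-xs) on-ys = on-time , OnTime-++⁺ xs on-xs on-ys

  infix 4 _⊴_
  _⊴_ : List A → List A → Set
  xs′ ⊴ xs = ∀ {s′ s} → s′ ≼[ 0 ] s → OnTime s xs → OnTime s′ xs′ × run s′ xs′ ≼[ 0 ] run s xs

  ⊴-refl : ∀ {xs} → xs ⊴ xs
  ⊴-refl {xs} = run-mono xs

  ⊴-trans : ∀ {xs ys zs} → xs ⊴ ys → ys ⊴ zs → xs ⊴ zs
  ⊴-trans xs⊴ys ys⊴zs s′≼s on-zs =
    let on-ys , ≼₁ = ys⊴zs ≼-refl on-zs
        on-xs , ≼₂ = xs⊴ys s′≼s on-ys
    in on-xs , ≼-trans ≼₂ ≼₁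

  ⊴-++ : ∀ {xs′ xs ys′ ys} → xs′ ⊴ xs → ys′ ⊴ ys → xs′ ++ ys′ ⊴ xs ++ ys
  ⊴-++ {xs′} {xs} {ys′} {ys} xs′⊴xs ys′⊴ys {s′} {s} s′≼s on-time =
    let on-xs , on-ys = OnTime-++⁻ xs on-time
        on-xs′ , ≼₁   = xs′⊴xs s′≼s on-xs
        on-ys′ , ≼₂   = ys′⊴ys ≼₁ on-ys
    in OnTime-++⁺ xs′ on-xs′ on-ys′ ,
       subst₂ (λ a b → a ≼[ 0 ] b) (sym (run-++ s′ xs′ ys′)) (sym (run-++ s xs ys)) ≼₂

  infix 4 _⊑_
  _⊑_ : List A → List A → Set
  xs′ ⊑ xs = xs′ ↭ xs × xs′ ⊴ xs

  ⊑-refl : ∀ {xs} → xs ⊑ xs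
  ⊑-refl = ↭-refl , ⊴-refl

  ⊑-trans : ∀ {xs ys zs} → xs ⊑ ys → ys ⊑ zs → xs ⊑ zs
  ⊑-trans (p , q) (p′ , q′) = ↭-trans p p′ , ⊴-trans q q′

  ⊑-++ : ∀ {xs′ xs ys′ ys} → xs′ ⊑ xs → ys′ ⊑ ys → xs′ ++ ys′ ⊑ xs ++ ys
  ⊑-++ (p , q) (p′ , q′) = ↭ₚ.++⁺ p p′ , ⊴-++ q q′

  -- Types are compared through zero setup in both directions rather than by equality,
  -- which is decidable although T need not have decidable equality.
  Equiv : A → A → Set
  Equiv x y = ℓ (τ (J x)) (τ (J y)) ≡ 0 × ℓ (τ (J y)) (τ (J x)) ≡ 0

  Precedes : A → A → Set
  Precedes y x = Equiv x y × d (J y) < d (J x)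

  precedes? : Decidable Precedes
  precedes? y x = ((ℓ (τ (J x)) (τ (J y)) ≟ 0) ×-dec (ℓ (τ (J y)) (τ (J x)) ≟ 0)) ×-dec (d (J y) <? d (J x))

  InOrder : A → A → Set
  InOrder x y = Equiv x y → d (J x) ≤ d (J y)

  -- Each job that y overtakes in insert y xs is one application of postpone below.
  insert : A → List A → List A
  insert y xs = filter (λ x → ¬? (precedes? y x)) xs ++ y ∷ filter (precedes? y) xs

  insert-precedes : ∀ {x y} xs → Precedes y x →
    insert y (x ∷ xs) ≡ filter (λ x → ¬? (precedes? y x)) xs ++ y ∷ x ∷ filter (precedes? y) xs
  insert-precedes xs y≺x = cong₂ (λ us vs → us ++ _ ∷ vs)
    (Listₚ.filter-reject (λ x → ¬? (precedes? _ x)) (λ y⊀x → y⊀x y≺x))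
    (Listₚ.filter-accept (precedes? _) y≺x)

  insert-¬precedes : ∀ {x y} xs → ¬ Precedes y x → insert y (x ∷ xs) ≡ x ∷ insert y xs
  insert-¬precedes xs y⊀x = cong₂ (λ us vs → us ++ _ ∷ vs)
    (Listₚ.filter-accept (λ x → ¬? (precedes? _ x)) y⊀x) (Listₚ.filter-reject (precedes? _) y⊀x)

  sort : List A → List A
  sort = foldl (flip insert) []

  module _ (tri : TriangleInequality ℓ) where

    zero-setup⇒≤ : ∀ {a b} → ℓ a b ≡ 0 → ∀ z → ℓ a z ≤ ℓ b z
    zero-setup⇒≤ {a} {b} ℓab≡0 z = subst (λ l → ℓ a z ≤ l + ℓ b z) ℓab≡0 (tri a b z)

    Equiv-trans : ∀ {x y z} → Equiv x y → Equiv y z → Equiv x z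
    Equiv-trans {x} {y} {z} (xy , yx) (yz , zy) =
      n≤0⇒n≡0 (subst (ℓ (τ (J x)) (τ (J z)) ≤_) yz (zero-setup⇒≤ xy (τ (J z)))) ,
      n≤0⇒n≡0 (subst (ℓ (τ (J z)) (τ (J x)) ≤_) yx (zero-setup⇒≤ zy (τ (J x))))

    ≼-step : ∀ s x → s ≼[ t (J x) ] step s x
    ≼-step start      x = ahead λ z → m≤m+n (t (J x)) _
    ≼-step (after τ′ c) x = ahead λ z → begin
      c + ℓ τ′ z + t (J x)                          ≤⟨ +-monoˡ-≤ (t (J x)) (+-monoʳ-≤ c (tri τ′ (τ (J x)) z)) ⟩
      c + (ℓ τ′ (τ (J x)) + ℓ (τ (J x)) z) + t (J x) ≡⟨ cong (_+ t (J x)) (+-assoc c _ _) ⟨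
      c + ℓ τ′ (τ (J x)) + ℓ (τ (J x)) z + t (J x)   ≡⟨ xy∙z≈xz∙y (c + ℓ τ′ (τ (J x))) _ _ ⟩
      c + ℓ τ′ (τ (J x)) + t (J x) + ℓ (τ (J x)) z   ∎
      where open ≤-Reasoning

    step-step-≼ : ∀ {s′ s x y} → Equiv x y → s′ ≼[ t (J x) ] s → step (step s′ y) x ≼[ 0 ] step s y
    step-step-≼ {s′} {s} {x} {y} (ℓxy≡0 , ℓyx≡0) s′≼s = ahead λ z → begin
      completion (step s′ y) x + ℓ (τ (J x)) z + 0 ≡⟨ +-identityʳ _ ⟩
      completion (step s′ y) x + ℓ (τ (J x)) z
        ≡⟨ cong (_+ ℓ (τ (J x)) z) (completion-step-zero-setup s′ ℓyx≡0) ⟩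
      completion s′ y + t (J x) + ℓ (τ (J x)) z
        ≤⟨ +-mono-≤ (completion-mono s′≼s y) (zero-setup⇒≤ ℓxy≡0 z) ⟩
      completion s y + ℓ (τ (J y)) z               ∎
      where open ≤-Reasoning

    -- Behind y, x needs no setup and finishes when y used to, which meets d (J y) < d (J x);
    -- the jobs in between gain the time t (J x).
    postpone : ∀ {x y} B G → Precedes y x → B ++ y ∷ x ∷ G ⊴ x ∷ B ++ y ∷ G
    postpone {x} {y} B G (x≈y , dy<dx) {s′} {s} s′≼s (_ , on-time) =
      let on-B , (on-y , on-G) = OnTime-++⁻ B on-time
          on-B′ , ≼B = run-mono B (≼-trans s′≼s (≼-step s x)) on-B
          on-G′ , ≼G = run-mono G (step-step-≼ x≈y ≼B) on-G
          on-x′ = <⇒≤ (begin-strict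
            completion (step (run s′ B) y) x   ≡⟨ completion-step-zero-setup (run s′ B) (proj₂ x≈y) ⟩
            completion (run s′ B) y + t (J x)  ≤⟨ completion-mono ≼B y ⟩
            completion (run (step s x) B) y    ≤⟨ on-y ⟩
            d (J y)                            <⟨ dy<dx ⟩
            d (J x)                            ∎)
      in OnTime-++⁺ B on-B′ (≤-trans (completion-≤ ≼B y) on-y , on-x′ , on-G′) ,
         subst₂ (λ a b → a ≼[ 0 ] b) (sym (run-++ s′ B (y ∷ x ∷ G))) (sym (run-++ (step s x) B (y ∷ G)))
                ≼G
      where open ≤-Reasoning

    postpone-⊑ : ∀ {x y} B G → Precedes y x → B ++ y ∷ x ∷ G ⊑ x ∷ B ++ y ∷ G
    postpone-⊑ {x} {y} B G y≺x =
      ↭-trans (↭ₚ.++⁺ˡ B (swap y x ↭-refl)) (↭ₚ.shift x B (y ∷ G)) , postpone B G y≺x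

    insert-⊑ : ∀ y xs → insert y xs ⊑ xs ++ [ y ]
    insert-⊑ y []       = ⊑-refl
    insert-⊑ y (x ∷ xs) with precedes? y x
    ... | yes y≺x = subst (_⊑ x ∷ xs ++ [ y ]) (sym (insert-precedes xs y≺x))
                      (⊑-trans (postpone-⊑ _ _ y≺x) (⊑-++ {xs′ = [ x ]} ⊑-refl (insert-⊑ y xs)))
    ... | no  y⊀x = subst (_⊑ x ∷ xs ++ [ y ]) (sym (insert-¬precedes xs y⊀x))
                      (⊑-++ {xs′ = [ x ]} ⊑-refl (insert-⊑ y xs))

    foldl-insert-⊑ : ∀ acc xs → foldl (flip insert) acc xs ⊑ acc ++ xs
    foldl-insert-⊑ acc []       = subst (acc ⊑_) (sym (Listₚ.++-identityʳ acc)) ⊑-refl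
    foldl-insert-⊑ acc (y ∷ xs) =
      subst (foldl (flip insert) (insert y acc) xs ⊑_) (Listₚ.++-assoc acc [ y ] xs)
        (⊑-trans (foldl-insert-⊑ (insert y acc) xs) (⊑-++ (insert-⊑ y acc) ⊑-refl))

    sort-⊑ : ∀ xs → sort xs ⊑ xs
    sort-⊑ = foldl-insert-⊑ []

    insert-InOrder : ∀ y {xs} → AllPairs InOrder xs → AllPairs InOrder (insert y xs)
    insert-InOrder y {xs} ordered = AllPairsₚ.++⁺ (AllPairsₚ.filter⁺ _ ordered)
      (All.map (λ (_ , dy<dx) _ → <⇒≤ dy<dx) later ∷ AllPairsₚ.filter⁺ _ ordered)
      (All.map before-y-and-later earlier)
      where
      earlier = Allₚ.all-filter (λ x → ¬? (precedes? y x)) xs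
      later   = Allₚ.all-filter (precedes? y) xs
      before-y-and-later : ∀ {x} → ¬ Precedes y x → All (InOrder x) (y ∷ filter (precedes? y) xs)
      before-y-and-later y⊀x = (λ x≈y → ≮⇒≥ λ dy<dx → y⊀x (x≈y , dy<dx))
        ∷ All.map (λ (z≈y , dy<dz) x≈z →
                     <⇒≤ (≤-<-trans (≮⇒≥ λ dy<dx → y⊀x (Equiv-trans x≈z z≈y , dy<dx)) dy<dz)) later

    foldl-insert-InOrder : ∀ {acc} xs → AllPairs InOrder acc → AllPairs InOrder (foldl (flip insert) acc xs)
    foldl-insert-InOrder []       ordered = ordered
    foldl-insert-InOrder (y ∷ xs) ordered = foldl-insert-InOrder xs (insert-InOrder y ordered)

    sort-InOrder : ∀ xs → AllPairs InOrder (sort xs)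
    sort-InOrder xs = foldl-insert-InOrder xs []

    concat-sort-⊑ : ∀ xss → concat (map sort xss) ⊑ concat xss
    concat-sort-⊑ []         = ⊑-refl
    concat-sort-⊑ (xs ∷ xss) = ⊑-++ (sort-⊑ xs) (concat-sort-⊑ xss)

  tardinessFrom : A → ℕ → List A → ℕ
  tardinessFrom x c xs =
    sum (zipWith (λ c j → c ∸ d j) (completionsFrom ℓ (J x) c (map J xs)) (J x ∷ map J xs))

  tardinessFrom≡0⇒OnTime : ∀ x c xs → tardinessFrom x c xs ≡ 0 →
                           c ≤ d (J x) × OnTime (after (τ (J x)) c) xs
  tardinessFrom≡0⇒OnTime x c []       ≡0 = m∸n≡0⇒m≤n (m+n≡0⇒m≡0 _ ≡0) , tt
  tardinessFrom≡0⇒OnTime x c (y ∷ xs) ≡0 =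
    m∸n≡0⇒m≤n (m+n≡0⇒m≡0 _ ≡0) , tardinessFrom≡0⇒OnTime y _ xs (m+n≡0⇒n≡0 _ ≡0)

  OnTime⇒tardinessFrom≡0 : ∀ x c xs → c ≤ d (J x) → OnTime (after (τ (J x)) c) xs →
                           tardinessFrom x c xs ≡ 0
  OnTime⇒tardinessFrom≡0 x c []       c≤d _ = cong (_+ 0) (m≤n⇒m∸n≡0 c≤d)
  OnTime⇒tardinessFrom≡0 x c (y ∷ xs) c≤d (on-time , rest) =
    cong₂ _+_ (m≤n⇒m∸n≡0 c≤d) (OnTime⇒tardinessFrom≡0 y _ xs on-time rest)

  Feasible⇒OnTime : ∀ xs → Feasible ℓ (map J xs) → OnTime start xs
  Feasible⇒OnTime []       _        = tt
  Feasible⇒OnTime (x ∷ xs) feasible = tardinessFrom≡0⇒OnTime x (t (J x)) xs feasible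

  OnTime⇒Feasible : ∀ xs → OnTime start xs → Feasible ℓ (map J xs)
  OnTime⇒Feasible []       _                = refl
  OnTime⇒Feasible (x ∷ xs) (on-time , rest) = OnTime⇒tardinessFrom≡0 x (t (J x)) xs on-time rest

  lastOr-completionsFrom : ∀ x c xs z →
    lastOr ℓ z (completionsFrom ℓ (J x) c (map J xs)) ≡ finish (run (after (τ (J x)) c) xs)
  lastOr-completionsFrom x c []       z = refl
  lastOr-completionsFrom x c (y ∷ xs) z = lastOr-completionsFrom y _ xs c

  makespan≡finish : ∀ xs → makespan ℓ (map J xs) ≡ finish (run start xs)
  makespan≡finish []       = refl
  makespan≡finish (x ∷ xs) = lastOr-completionsFrom x (t (J x)) xs 0

  module _ (zd : ZeroOnDiagonal ℓ) where

    InOrder⇒EDDS : ∀ {xs} → AllPairs InOrder xs → EDDS (map J xs)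
    InOrder⇒EDDS = AllPairsₚ.map⁺ ∘ AllPairs.map λ {x} {y} x≤y τx≡τy → x≤y (same-type-Equiv τx≡τy)
      where
      same-type-Equiv : ∀ {x y} → τ (J x) ≡ τ (J y) → Equiv x y
      same-type-Equiv {x} τx≡τy rewrite τx≡τy = zd _ , zd _

    finish-mono : ∀ {s′ s} → s′ ≼[ 0 ] s → finish s′ ≤ finish s
    finish-mono {start}      _   = z≤n
    finish-mono {after τ′ c′} {start} s′≼s = ≤-trans (m≤m+n c′ _) (≤-trans (m≤m+n _ 0) (ready-≤ s′≼s τ′))
    finish-mono {after τ′ c′} {after τ c} s′≼s = begin
      c′                       ≤⟨ ≤-trans (m≤m+n c′ _) (m≤m+n _ 0) ⟩
      c′ + ℓ τ′ τ + 0          ≤⟨ ready-≤ s′≼s τ ⟩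
      c + ℓ τ τ                ≡⟨ cong (c +_) (zd τ) ⟩
      c + 0                    ≡⟨ +-identityʳ c ⟩
      c                        ∎
      where open ≤-Reasoning

    ⊴-Feasible : ∀ {xs′ xs} → xs′ ⊴ xs → Feasible ℓ (map J xs) →
                 Feasible ℓ (map J xs′) × makespan ℓ (map J xs′) ≤ makespan ℓ (map J xs)
    ⊴-Feasible {xs′} {xs} xs′⊴xs feasible =
      let on-time , ≼-end = xs′⊴xs ≼-refl (Feasible⇒OnTime xs feasible)
      in OnTime⇒Feasible xs′ on-time ,
         subst₂ _≤_ (sym (makespan≡finish xs′)) (sym (makespan≡finish xs)) (finish-mono ≼-end)

ids-Unique : ∀ {n} (σ : Schedule n) → Unique (ids σ)
ids-Unique (_ , injective) = Uniqueₚ.tabulate⁺ injective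

∈-ids : ∀ {n} (σ : Schedule n) x → x ∈ ids σ
∈-ids (f , injective) x with i , fi≡x ← injective⇒surjective injective x =
  subst (_∈ tabulate f) fi≡x (∈ₚ.∈-tabulate⁺ i)

ids-SameSet : ∀ {n} (σ σ′ : Schedule n) → SameSet (ids σ) (ids σ′)
ids-SameSet σ σ′ x = mk⇔ (λ _ → ∈-ids σ′ x) (λ _ → ∈-ids σ x)

↭-schedule : ∀ {n} (σ : Schedule n) {xs} → xs ↭ ids σ → ∃[ σ′ ] ids σ′ ≡ xs
↭-schedule {n} σ {xs} xs↭σ =
  let f , f-injective , tabulate-f≡xs = Unique⇒tabulate xs
        (trans (↭ₚ.↭-length xs↭σ) (Listₚ.length-tabulate (proj₁ σ)))
        (↭ₛₚ.Unique-resp-↭ (setoid (Fin n)) (↭⇒↭ₛ (↭-sym xs↭σ)) (ids-Unique σ))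
  in (f , f-injective) , tabulate-f≡xs

module _ {T : Set} {ℓ : SetupMapping T} {n : ℕ} {J : Fin n → Job T} where
  open Timing ℓ J

  Better⇒differs : ∀ π σ → Better ℓ J π σ → ∃ λ i → proj₁ π i ≢ proj₁ σ i
  Better⇒differs (π , _) (σ , _) (_ , shorter) = Finₚ.¬∀⟶∃¬ n _ (λ i → π i Finₚ.≟ σ i) λ π≗σ →
    <-irrefl (cong (makespan ℓ ∘ map J) (sym (Listₚ.tabulate-cong π≗σ))) shorter

  ⊑-Better : ZeroOnDiagonal ℓ → ∀ {π σ xs} → Better ℓ J π σ → xs ⊑ ids σ →
             ∃[ π′ ] ids π′ ≡ xs × Better ℓ J π π′
  ⊑-Better zd {σ = σ} (σ-feasible , shorter) (xs↭σ , xs⊴σ) with π′ , ids≡xs ← ↭-schedule σ xs↭σ =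
    let feasible , no-later = ⊴-Feasible zd xs⊴σ σ-feasible
    in π′ , ids≡xs , subst (Feasible ℓ ∘ map J) (sym ids≡xs) feasible ,
       ≤-<-trans (≤-reflexive (cong (makespan ℓ ∘ map J) ids≡xs)) (≤-<-trans no-later shorter)

-- Window distance

lastFin-∈ : ∀ {n} (a : Fin n) rest → lastFin a rest ∈ a ∷ rest
lastFin-∈ a []           = here refl
lastFin-∈ a (a′ ∷ rest) = there (lastFin-∈ a′ rest)

sorted-bounds : ∀ {n} {a : Fin n} {rest i} → AllPairs _<ᶠ_ (a ∷ rest) → i ∈ a ∷ rest →
                toℕ a ≤ toℕ i × toℕ i ≤ toℕ (lastFin a rest)
sorted-bounds {rest = []}        _                     (here refl) = ≤-refl , ≤-refl
sorted-bounds {rest = a′ ∷ rest} ((a<a′ ∷ _) ∷ sorted) (here refl) =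
  ≤-refl , <⇒≤ (<-≤-trans a<a′ (proj₁ (sorted-bounds sorted (lastFin-∈ a′ rest))))
sorted-bounds {rest = a′ ∷ rest} ((a<a′ ∷ _) ∷ sorted) (there i∈) =
  let a′≤i , i≤last = sorted-bounds sorted i∈ in <⇒≤ (<-≤-trans a<a′ a′≤i) , i≤last

module _ {n : ℕ} where

  _∉[_,_] : Fin n → ℕ → ℕ → Set
  i ∉[ a , b ] = toℕ i < a ⊎ b < toℕ i

  module _ (π σ : Schedule n) where

    ∈-diffPositions : ∀ i → proj₁ π i ≢ proj₁ σ i → i ∈ diffPositions π σ
    ∈-diffPositions i = ∈ₚ.∈-filter⁺ (λ j → ¬? (proj₁ π j Finₚ.≟ proj₁ σ j)) (∈ₚ.∈-allFin i)

    diffPositions-differ : All (λ i → proj₁ π i ≢ proj₁ σ i) (diffPositions π σ)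
    diffPositions-differ = Allₚ.all-filter (λ j → ¬? (proj₁ π j Finₚ.≟ proj₁ σ j)) (allFin n)

    diffPositions-sorted : AllPairs _<ᶠ_ (diffPositions π σ)
    diffPositions-sorted =
      AllPairsₚ.filter⁺ (λ j → ¬? (proj₁ π j Finₚ.≟ proj₁ σ j)) (AllPairsₚ.tabulate⁺-< (λ i<j → i<j))

    firstLastDiff : (∃ λ i → proj₁ π i ≢ proj₁ σ i) →
                    ∃[ a ] ∃[ b ] (FirstLastDiff π σ a b × windowDist π σ ≡ suc (toℕ b ∸ toℕ a))
    firstLastDiff (i , πi≢σi)
      with diffPositions π σ | ∈-diffPositions | diffPositions-differ | diffPositions-sorted
    ... | []       | complete | _     | _      with () ← complete i πi≢σi
    ... | a ∷ rest | complete | sound | sorted = a , lastFin a rest ,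
      (All.head sound , All.lookup sound (lastFin-∈ a rest) ,
       λ j πj≢σj → sorted-bounds sorted (complete j πj≢σj)) , refl

    FirstLastDiff-≤ : ∀ {a b} → FirstLastDiff π σ a b → toℕ a ≤ toℕ b
    FirstLastDiff-≤ (_ , πb≢σb , bounds) = proj₁ (bounds _ πb≢σb)

    FirstLastDiff⇒agree : ∀ {a b} → FirstLastDiff π σ a b →
                          ∀ i → i ∉[ toℕ a , toℕ b ] → proj₁ π i ≡ proj₁ σ i
    FirstLastDiff⇒agree (_ , _ , bounds) i outside with proj₁ π i Finₚ.≟ proj₁ σ i
    ... | yes πi≡σi = πi≡σi
    ... | no  πi≢σi with a≤i , i≤b ← bounds i πi≢σi with outside
    ...   | inj₁ i<a = contradiction a≤i (<⇒≱ i<a)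
    ...   | inj₂ b<i = contradiction i≤b (<⇒≱ b<i)

    agree⇒FirstLastDiff-within : ∀ {lo hi a b} → (∀ i → i ∉[ lo , hi ] → proj₁ π i ≡ proj₁ σ i) →
                                 FirstLastDiff π σ a b → lo ≤ toℕ a × toℕ b ≤ hi
    agree⇒FirstLastDiff-within agree (πa≢σa , πb≢σb , _) =
      ≮⇒≥ (λ a<lo → πa≢σa (agree _ (inj₁ a<lo))) , ≮⇒≥ (λ hi<b → πb≢σb (agree _ (inj₂ hi<b)))

module _ {T : Set} {ℓ : SetupMapping T} (zd : ZeroOnDiagonal ℓ) (tri : TriangleInequality ℓ)
         {n : ℕ} {J : Fin n → Job T} where
  open Timing ℓ J

  sort-window : ∀ {π σ a b P X S} → Better ℓ J π σ → FirstLastDiff π σ a b →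
    ids σ ≡ P ++ X ++ S → length P ≡ toℕ a → length P + length X ≡ suc (toℕ b) →
    ∃[ π′ ] (Better ℓ J π π′ × (∀ i → i ∉[ toℕ a , toℕ b ] → proj₁ π i ≡ proj₁ π′ i) ×
             (∀ {i j} → toℕ a ≤ i → i ≤ j → j ≤ toℕ b → EDDS (slice i j (jobsOf J π′))))
  sort-window {π} {σ} {a} {b} {P} {X} {S} σ-better σ-diff σ≡PXS |P|≡a |PX|≡1+b
    with π′ , π′≡PXS , π′-better ← ⊑-Better zd {π} {σ} σ-better
           (subst (P ++ sort X ++ S ⊑_) (sym σ≡PXS) (⊑-++ (⊑-refl {P}) (⊑-++ (sort-⊑ tri X) (⊑-refl {S}))))
    = π′ , π′-better , agree , edds
    where
    |sortX|≡|X| : length (sort X) ≡ length X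
    |sortX|≡|X| = ↭ₚ.↭-length (proj₁ (sort-⊑ tri X))
    agree : ∀ i → i ∉[ toℕ a , toℕ b ] → proj₁ π i ≡ proj₁ π′ i
    agree i outside = trans (FirstLastDiff⇒agree π σ σ-diff i outside)
      (tabulate-≡-outside P {X} {sort X} {S} (sym |sortX|≡|X|) σ≡PXS π′≡PXS i (outside-PX outside))
      where
      outside-PX : i ∉[ toℕ a , toℕ b ] → toℕ i < length P ⊎ length P + length X ≤ toℕ i
      outside-PX (inj₁ i<a) = inj₁ (subst (toℕ i <_) (sym |P|≡a) i<a)
      outside-PX (inj₂ b<i) = inj₂ (subst (_≤ toℕ i) (sym |PX|≡1+b) b<i)
    edds : ∀ {i j} → toℕ a ≤ i → i ≤ j → j ≤ toℕ b → EDDS (slice i j (jobsOf J π′))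
    edds {i} {j} a≤i i≤j j≤b = subst (λ xs → EDDS (slice i j (map J xs))) (sym π′≡PXS)
      (subst EDDS (sym (slice-map J i j (P ++ sort X ++ S)))
        (InOrder⇒EDDS zd (AllPairs-slice P S (sort-InOrder tri X) (subst (_≤ i) (sym |P|≡a) a≤i) i≤j
          (subst (j <_) (trans (sym |PX|≡1+b) (cong (length P +_) (sym |sortX|≡|X|))) (s≤s j≤b)))))

  window-normal-form : ∀ {π k} → (∃[ σ ] (Better ℓ J π σ × windowDist π σ ≤ k)) →
    ∃[ π′ ] (Better ℓ J π π′ × windowDist π π′ ≤ k ×
      ∃[ a ] ∃[ b ] (FirstLastDiff π π′ a b × EDDS (slice (toℕ a) (toℕ b) (jobsOf J π′))))
  window-normal-form {π} {k} (σ , σ-better , σ-near)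
    with a , b , σ-diff , σ-dist ← firstLastDiff π σ (Better⇒differs π σ σ-better)
    with P , X , S , σ≡PXS , |P|≡a , |PX|≡1+b ← window-split (ids σ) (FirstLastDiff-≤ π σ σ-diff)
                                                  (subst (toℕ b <_) (sym (Listₚ.length-tabulate _)) (Finₚ.toℕ<n b))
    with π′ , π′-better , agree , edds ←
           sort-window {π} {σ} {P = P} {X} {S} σ-better σ-diff σ≡PXS |P|≡a |PX|≡1+b
    with a′ , b′ , π′-diff , π′-dist ← firstLastDiff π π′ (Better⇒differs π π′ π′-better)
    with a≤a′ , b′≤b ← agree⇒FirstLastDiff-within π π′ agree π′-diff
    = π′ , π′-better , π′-near , a′ , b′ , π′-diff , edds a≤a′ (FirstLastDiff-≤ π π′ π′-diff) b′≤b
    where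
    π′-near : windowDist π π′ ≤ k
    π′-near = begin
      windowDist π π′      ≡⟨ π′-dist ⟩
      suc (toℕ b′ ∸ toℕ a′) ≤⟨ s≤s (∸-mono b′≤b a≤a′) ⟩
      suc (toℕ b ∸ toℕ a)   ≡⟨ σ-dist ⟨
      windowDist π σ       ≤⟨ σ-near ⟩
      k                    ∎
      where open ≤-Reasoning

-- Multi-window distance

module _ {A : Set} {k : ℕ} where

  Decomp-length : ∀ {xs ys : List A} → Decomp k xs ys → length xs ≡ length ys
  Decomp-length (short |xs|≡|ys| _) = |xs|≡|ys|
  Decomp-length (split {xs₁} {_} {ys₁} |xs₂|≡|ys₂| _ _ D) =
    trans (Listₚ.length-++ xs₁) (trans (cong₂ _+_ (Decomp-length D) |xs₂|≡|ys₂|) (sym (Listₚ.length-++ ys₁)))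

  Block : List A → List A → Set
  Block xs ys = length xs ≡ length ys × 1 ≤ length xs × length xs ≤ k × SameSet xs ys

  Blocks : List A → List A → Set
  Blocks xs ys = ∃[ xss ] ∃[ yss ] (concat xss ≡ xs × concat yss ≡ ys × Pointwise Block xss yss)

  block : ∀ {xs ys} → length xs ≡ length ys → length xs ≤ k → SameSet xs ys → Blocks xs ys
  block {[]}     {[]}     _         _      _    = [] , [] , refl , refl , []
  block {x ∷ xs} {y ∷ ys} |xs|≡|ys| |xs|≤k same = [ x ∷ xs ] , [ y ∷ ys ] ,
    Listₚ.++-identityʳ _ , Listₚ.++-identityʳ _ , (|xs|≡|ys| , s≤s z≤n , |xs|≤k , same) ∷ []

  Blocks-++ : ∀ {xs ys xs′ ys′} → Blocks xs ys → Blocks xs′ ys′ → Blocks (xs ++ xs′) (ys ++ ys′)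
  Blocks-++ (xss , yss , refl , refl , bs) (xss′ , yss′ , refl , refl , bs′) =
    xss ++ xss′ , yss ++ yss′ , sym (Listₚ.concat-++ xss xss′) , sym (Listₚ.concat-++ yss yss′) ,
    Pointwise.++⁺ bs bs′

  -- Decomp does not ask the first window to have the same jobs in both sequences; for sequences
  -- without repetitions it does once the whole sequences and all later windows do.
  Decomp⇒Blocks : ∀ {xs ys} → Decomp k xs ys → Unique xs → Unique ys → SameSet xs ys → Blocks xs ys
  Decomp⇒Blocks (short |xs|≡|ys| |xs|≤k) _ _ same = block |xs|≡|ys| |xs|≤k same
  Decomp⇒Blocks (split {xs₁} {_} {ys₁} |xs₂|≡|ys₂| |xs₂|≤k same₂ D) xs! ys! same = Blocks-++
    (Decomp⇒Blocks D (Unique-++⁻ˡ xs₁ xs!) (Unique-++⁻ˡ ys₁ ys!)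
                     (SameSet-++-cancelʳ xs₁ ys₁ xs! ys! same same₂))
    (block |xs₂|≡|ys₂| |xs₂|≤k same₂)

  Decomp-++-Blocks : ∀ {xs ys xss yss} → Decomp k xs ys → Pointwise Block xss yss →
                     Decomp k (xs ++ concat xss) (ys ++ concat yss)
  Decomp-++-Blocks {xs} {ys} D [] =
    subst₂ (Decomp k) (sym (Listₚ.++-identityʳ xs)) (sym (Listₚ.++-identityʳ ys)) D
  Decomp-++-Blocks {xs} {ys} {xs₂ ∷ xss} {ys₂ ∷ yss} D ((|xs₂|≡|ys₂| , _ , |xs₂|≤k , same) ∷ bs) =
    subst₂ (Decomp k) (Listₚ.++-assoc xs xs₂ (concat xss)) (Listₚ.++-assoc ys ys₂ (concat yss))
      (Decomp-++-Blocks (split |xs₂|≡|ys₂| |xs₂|≤k same D) bs)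

  Blocks⇒Decomp : ∀ {xss yss} → Pointwise Block xss yss → Decomp k (concat xss) (concat yss)
  Blocks⇒Decomp = Decomp-++-Blocks (short refl z≤n)

  Cut : List A → List A → ℕ → Set
  Cut xs ys p = SameSet (drop p xs) (drop p ys) × Decomp k (take p xs) (take p ys)

  Cut⇒Decomp : ∀ {xs ys p} → length xs ≡ length ys → length xs ∸ p ≤ k → Cut xs ys p → Decomp k xs ys
  Cut⇒Decomp {xs} {ys} {p} |xs|≡|ys| |xs|∸p≤k (same , D) =
    subst₂ (Decomp k) (Listₚ.take++drop≡id p xs) (Listₚ.take++drop≡id p ys)
      (split (trans (Listₚ.length-drop p xs) (trans (cong (_∸ p) |xs|≡|ys|) (sym (Listₚ.length-drop p ys))))
             (subst (_≤ k) (sym (Listₚ.length-drop p xs)) |xs|∸p≤k) same D)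

  Decomp⇒Cut : ∀ {xs ys} → Decomp k xs ys → k < length xs →
               ∃ λ j → j < k × Cut xs ys (length xs ∸ suc j)
  Decomp⇒Cut (short _ |xs|≤k) k<|xs| = contradiction |xs|≤k (<⇒≱ k<|xs|)
  Decomp⇒Cut (split {xs₁} {[]} {ys₁} {[]} _ _ _ D) k<|xs| =
    subst₂ (λ xs ys → ∃ λ j → j < k × Cut xs ys (length xs ∸ suc j))
           (sym (Listₚ.++-identityʳ xs₁)) (sym (Listₚ.++-identityʳ ys₁))
      (Decomp⇒Cut D (subst (k <_) (cong length (Listₚ.++-identityʳ xs₁)) k<|xs|))
  Decomp⇒Cut (split {xs₁} {x ∷ xs₂} {ys₁} {y ∷ ys₂} _ |xs₂|≤k same D) _ =
    length xs₂ , |xs₂|≤k , subst (Cut (xs₁ ++ x ∷ xs₂) (ys₁ ++ y ∷ ys₂)) (sym cut≡|xs₁|)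
      (subst₂ SameSet (sym (drop-length-++ xs₁))
                      (sym (trans (cong (λ p → drop p _) |xs₁|≡|ys₁|) (drop-length-++ ys₁))) same ,
       subst₂ (Decomp k) (sym (take-length-++ xs₁))
                         (sym (trans (cong (λ p → take p _) |xs₁|≡|ys₁|) (take-length-++ ys₁))) D)
    where
    |xs₁|≡|ys₁| = Decomp-length D
    cut≡|xs₁| : length (xs₁ ++ x ∷ xs₂) ∸ suc (length xs₂) ≡ length xs₁
    cut≡|xs₁| =
      trans (cong (_∸ suc (length xs₂)) (Listₚ.length-++ xs₁)) (m+n∸n≡m (length xs₁) (length (x ∷ xs₂)))
  Decomp⇒Cut (split {xs₂ = []}    {ys₂ = _ ∷ _} () _ _ _) _
  Decomp⇒Cut (split {xs₂ = _ ∷ _} {ys₂ = []}    () _ _ _) _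

module _ {n : ℕ} where
  open DecMembership (Finₚ._≟_ {n}) using (_∈?_)

  SameSet? : (xs ys : List (Fin n)) → Dec (SameSet xs ys)
  SameSet? xs ys = Finₚ.all? λ x →
    map′ (λ (to , from) → mk⇔ to from) (λ x⇔ → Equivalence.to x⇔ , Equivalence.from x⇔)
         ((x ∈? xs →-dec x ∈? ys) ×-dec (x ∈? ys →-dec x ∈? xs))

  -- The multi-window distance is a least k with Decomp k, which exists constructively by decidability.
  Decomp? : ∀ k (xs ys : List (Fin n)) → Dec (Decomp k xs ys)
  Decomp? k xs ys = bounded (length xs) xs ys ≤-refl
    where
    bounded : ∀ fuel xs ys → length xs ≤ fuel → Dec (Decomp k xs ys)
    bounded fuel xs ys _ with length xs ≟ length ys | length xs ≤? k
    ... | no  |xs|≢|ys| | _         = no (|xs|≢|ys| ∘ Decomp-length)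
    ... | yes |xs|≡|ys| | yes |xs|≤k = yes (short |xs|≡|ys| |xs|≤k)
    bounded zero       xs ys |xs|≤0      | yes _         | no |xs|≰k =
      contradiction (≤-trans |xs|≤0 z≤n) |xs|≰k
    bounded (suc fuel) xs ys |xs|≤1+fuel | yes |xs|≡|ys| | no |xs|≰k =
      map′ (λ (j , j<k , cut) → Cut⇒Decomp |xs|≡|ys| (window≤k j<k) cut) (λ D → Decomp⇒Cut D k<|xs|)
        (anyUpTo? (λ j → SameSet? _ _ ×-dec bounded fuel _ _ (prefix≤fuel j)) k)
      where
      k<|xs| = ≰⇒> |xs|≰k
      window≤k : ∀ {j} → j < k → length xs ∸ (length xs ∸ suc j) ≤ k
      window≤k j<k = ≤-trans (≤-reflexive (m∸[m∸n]≡n (<-trans j<k k<|xs|))) j<k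
      prefix≤fuel : ∀ j → length (take (length xs ∸ suc j) xs) ≤ fuel
      prefix≤fuel j = begin
        length (take (length xs ∸ suc j) xs) ≡⟨ Listₚ.length-take _ xs ⟩
        (length xs ∸ suc j) ⊓ length xs     ≤⟨ m⊓n≤m _ _ ⟩
        length xs ∸ suc j                   ≤⟨ ∸-monoʳ-≤ (length xs) (s≤s z≤n) ⟩
        length xs ∸ 1                       ≤⟨ ∸-monoˡ-≤ 1 |xs|≤1+fuel ⟩
        fuel                                ∎
        where open ≤-Reasoning

module _ {T : Set} {ℓ : SetupMapping T} (zd : ZeroOnDiagonal ℓ) (tri : TriangleInequality ℓ)
         {n : ℕ} {J : Fin n → Job T} where
  open Timing ℓ J

  sort-Blocks : ∀ {m k xss yss} → m ≤ k → Pointwise (Block {k = m}) xss yss →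
                GoodBlocks J k xss (map sort yss)
  sort-Blocks m≤k []                                                    = []
  sort-Blocks {yss = ys ∷ _} m≤k ((|xs|≡|ys| , 1≤|xs| , |xs|≤m , same) ∷ bs) =
    (trans |xs|≡|ys| (sym (↭ₚ.↭-length sort↭)) , 1≤|xs| , ≤-trans |xs|≤m m≤k ,
     SameSet-↭ʳ (↭-sym sort↭) same , InOrder⇒EDDS zd (sort-InOrder tri ys)) ∷ sort-Blocks m≤k bs
    where
    sort↭ = proj₁ (sort-⊑ tri ys)

  multi-window-normal-form : ∀ {π k} → (∃[ σ ] (Better ℓ J π σ × MultiWindowDist≤ π σ k)) →
    ∃[ π′ ] (Better ℓ J π π′ × MultiWindowDist≤ π π′ k × MultiWindowNormalForm J k π π′)
  multi-window-normal-form {π} {k} (σ , σ-better , m , (σ-decomp , _) , m≤k)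
    with xss , yss , xss≡π , yss≡σ , blocks ←
           Decomp⇒Blocks σ-decomp (ids-Unique π) (ids-Unique σ) (ids-SameSet π σ)
    with π′ , π′≡ , π′-better ←
           ⊑-Better zd {π} {σ} σ-better (subst (concat (map sort yss) ⊑_) yss≡σ (concat-sort-⊑ tri yss))
    = π′ , π′-better , least (λ m → Decomp? m (ids π) (ids π′)) π′-decomp ,
      xss , map sort yss , xss≡π , sym π′≡ , good
    where
    good : GoodBlocks J k xss (map sort yss)
    good = sort-Blocks m≤k blocks
    π′-decomp : Decomp k (ids π) (ids π′)
    π′-decomp = subst₂ (Decomp k) xss≡π (sym π′≡)
      (Blocks⇒Decomp (Pointwise.map (λ (|xs|≡|ys| , 1≤|xs| , |xs|≤k , same , _) → |xs|≡|ys| , 1≤|xs| , |xs|≤k , same)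
                                    good))

proposition1 : {T : Set} (ℓ : SetupMapping T) → ZeroOnDiagonal ℓ → TriangleInequality ℓ →
    (n : ℕ) (J : Fin n → Job T) (π : Schedule n) → Feasible ℓ (jobsOf J π) → (k : ℕ) →
    ((∃[ σ ] (Better ℓ J π σ × windowDist π σ ≤ k)) →
      ∃[ π' ] (Better ℓ J π π' × windowDist π π' ≤ k ×
        ∃[ a ] ∃[ b ] (FirstLastDiff π π' a b × EDDS (slice (toℕ a) (toℕ b) (jobsOf J π')))))
    ×
    ((∃[ σ ] (Better ℓ J π σ × MultiWindowDist≤ π σ k)) →
      ∃[ π' ] (Better ℓ J π π' × MultiWindowDist≤ π π' k × MultiWindowNormalForm J k π π'))
proposition1 ℓ zd tri n J π _ k =
  window-normal-form zd tri {J = J} {π} {k} , multi-window-normal-form zd tri {J = J} {π} {k}
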